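{- Let $\epsilon$ be a positive integer. Let $G=\langle\alpha,\beta\rangle$ be the group of bijections of $\mathbb{Q}_+^5$ generated by $$\alpha(a,b,c,d,e)=\Big(b,\tfrac{b^2+cd}{a},c,d,e\Big),\qquad \beta(a,b,c,d,e)=\Big(b,c,\tfrac{ac+be}{d},a,e\Big),$$ and let $\varphi:\mathbb{Q}_+^5\to\mathbb{Q}_+^3$ be $$\varphi(a,b,c,d,e)=\Big(\frac{a^2+b^2+cd}{ab},\ \frac{c^2d+a^2c+b^2d+abe}{bcd},\ \frac{cd^2+a^2c+b^2d+abe}{acd}\Big).$$ Let $P=(a,b,c,d,\epsilon)\in\mathbb{N}^5$ with $\varphi(P)\in\mathbb{N}^3$ and $P\equiv 0\pmod{\epsilon}$. Then for every $g\in G$ we have $\varphi(g(P))\in\mathbb{N}^3$ and $g(P)\equiv 0\pmod{\epsilon}$.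
   Context: $\mathbb{N}$ denotes the positive integers and $\mathbb{Q}_+$ the positive rationals. For a vector $P$, $P\equiv 0\pmod{\epsilon}$ means every component of $P$ is an integer divisible by $\epsilon$. -}

module Defs where

open import Data.Nat as ℕ using (ℕ; suc)
open import Data.Integer as ℤ using (ℤ; +_)
open import Data.Rational using (ℚ; 0ℚ; _+_; _*_; _/_; _÷_; ≢-nonZero)
open import Data.Rational.Properties using (_≟_)
open import Data.Product using (Σ; ∃; _×_)
open import Data.List using (List; []; _∷_)
open import Relation.Binary.PropositionalEquality using (_≡_)
open import Relation.Nullary using (yes; no)

-- Division on ℚ; the junk value 0 at divisor 0 never occurs on ℚ₊ (all maps below
-- preserve positivity), so on the orbit of P this is the genuine division.
_⊘_ : ℚ → ℚ → ℚ
x ⊘ y with y ≟ 0ℚ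
... | yes _ = 0ℚ
... | no y≢0 = _÷_ x y {{≢-nonZero y≢0}}

ι : ℕ → ℚ
ι n = (+ n) / 1

-- points of ℚ₊⁵ (positivity is guaranteed on the orbit of P)
record Q5 : Set where
  constructor ⟨_,_,_,_,_⟩
  field
    a b c d e : ℚ

record Q3 : Set where
  constructor ⟨_,_,_⟩
  field
    x y z : ℚ

αmap : Q5 → Q5
αmap ⟨ a , b , c , d , e ⟩ = ⟨ b , (b * b + c * d) ⊘ a , c , d , e ⟩

αinv : Q5 → Q5
αinv ⟨ a , b , c , d , e ⟩ = ⟨ (a * a + c * d) ⊘ b , a , c , d , e ⟩

βmap : Q5 → Q5
βmap ⟨ a , b , c , d , e ⟩ = ⟨ b , c , (a * c + b * e) ⊘ d , a , e ⟩

βinv : Q5 → Q5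
βinv ⟨ a , b , c , d , e ⟩ = ⟨ d , a , b , (d * b + a * e) ⊘ c , e ⟩

data Gen : Set where
  α α⁻¹ β β⁻¹ : Gen

genMap : Gen → Q5 → Q5
genMap α = αmap
genMap α⁻¹ = αinv
genMap β = βmap
genMap β⁻¹ = βinv

Word : Set
Word = List Gen

act : Word → Q5 → Q5
act [] p = p
act (s ∷ w) p = genMap s (act w p)

φ : Q5 → Q3
φ ⟨ a , b , c , d , e ⟩ =
  ⟨ (a * a + b * b + c * d) ⊘ (a * b)
  , (c * c * d + a * a * c + b * b * d + a * b * e) ⊘ (b * c * d)
  , (c * d * d + a * a * c + b * b * d + a * b * e) ⊘ (a * c * d) ⟩

IsPosNat : ℚ → Set
IsPosNat q = ∃ λ (n : ℕ) → q ≡ ι (suc n)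

InN3 : Q3 → Set
InN3 ⟨ x , y , z ⟩ = IsPosNat x × IsPosNat y × IsPosNat z

DivBy : ℕ → ℚ → Set
DivBy ε q = ∃ λ (k : ℤ) → q ≡ (k ℤ.* + ε) / 1

Zmod : ℕ → Q5 → Set
Zmod ε ⟨ a , b , c , d , e ⟩ = DivBy ε a × DivBy ε b × DivBy ε c × DivBy ε d × DivBy ε e

{-# OPTIONS --safe #-}
module Submission where

-- Clearing denominators, "φ(a,b,c,d,e) = (x,y,z)" becomes three polynomial identities
-- (ΦEquations).  Each generator replaces one coordinate by its Vieta partner: α replaces a by
-- a′ = xb − a, where a a′ = b² + cd, and similarly α⁻¹ uses b′ = xa − b, β uses
-- c′ = zc − xb + a with c′ d = ac + be, and β⁻¹ uses d′ = yd − xa + b with d′ c = db + ae.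
-- The new coordinate is therefore an integer combination of the old ones (so still ≡ 0 mod ε),
-- positive because its product with a positive coordinate is positive, and the image point
-- satisfies the φ-equations again with the φ-values permuted or replaced (e.g. (x, z, xz − y)
-- for α).

open import Defs
open import Data.Nat using (ℕ; suc; _<_; z<s)
open import Data.Product using (_×_; proj₁; proj₂)
open import Relation.Binary.PropositionalEquality using (subst; sym; trans; cong)

-- The development lives in a module so that Data.Product's _,_ stays out of scope at the top
-- level, where it would make the ⟨_,_,_,_,_⟩ of the statement below ambiguous; for the same
-- reason points are written in prefix form ⟨_,_,_,_,_⟩ a b c d e inside it.
module Orbit where
  open import Algebra.Bundles using (AbelianGroup)
  open import Data.Empty using (⊥-elim)
  open import Data.Integer using (ℤ; +_; +0; +[1+_]; -[1+_]; -_; _+_; _-_; _*_; NonZero; ∣_∣)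
  open import Data.Integer.Divisibility.Signed
    using (_∣_; divides; ∣-refl; ∣m∣n⇒∣m+n; ∣m∣n⇒∣m-n; ∣n⇒∣m*n)
  open import Data.Integer.Properties using (*-cancelˡ-≡; i*j≢0; +-0-abelianGroup)
  open import Data.Integer.Tactic.RingSolver using (solve; solve-∀)
  open import Data.List using (_∷_; [])
  open import Data.Nat as ℕ using ()
  open import Data.Nat.Coprimality using (1-coprimeTo) renaming (sym to coprime-sym)
  open import Data.Product using (Σ-syntax; ∃; _,_)
  open import Data.Rational as ℚ using (ℚ; mkℚ; 0ℚ; 1/_; ↥_; _/_; ≢-nonZero)
  open import Data.Rational.Properties as ℚ using (↥p/↧p≡p; _≟_)
  open import Function.Bundles using (_⇔_; mk⇔; module Equivalence)
  open import Relation.Nullary using (yes; no)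
  open import Relation.Binary.PropositionalEquality
  open import Algebra.Properties.Group (AbelianGroup.group +-0-abelianGroup)
    using () renaming (∙-cancelʳ to +-cancelʳ)

  record ΦEquations (a b c d e x y z : ℤ) : Set where
    field
      x-eq : x * (a * b) ≡ a * a + b * b + c * d
      y-eq : y * (b * c * d) ≡ c * c * d + a * a * c + b * b * d + a * b * e
      z-eq : z * (a * c * d) ≡ c * d * d + a * a * c + b * b * d + a * b * e

  combination : ∀ {l r L₁ R₁ L₂ R₂ L₃ R₃ : ℤ} (m : ℤ) .{{_ : NonZero m}} (q₁ q₂ q₃ : ℤ) →
    L₁ ≡ R₁ → L₂ ≡ R₂ → L₃ ≡ R₃ →
    m * l + (q₁ * R₁ + q₂ * R₂ + q₃ * R₃) ≡ m * r + (q₁ * L₁ + q₂ * L₂ + q₃ * L₃) →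
    l ≡ r
  combination m _ _ _ refl refl refl eq = *-cancelˡ-≡ m _ _ (+-cancelʳ _ _ _ eq)

  -- The polynomial arguments of `combination` below are certificates: a multiplier m and
  -- cofactors q₁ q₂ q₃ exhibiting each identity as a consequence of the φ-equations.
  module _ {a b c d e x y z : ℤ} (eqs : ΦEquations a b c d e x y z) where
    open ΦEquations eqs

    α-exchange : (x * b - a) * a ≡ b * b + c * d
    α-exchange = combination (+ 1) (+ 1) (+ 0) (+ 0) x-eq y-eq z-eq
      (solve (a ∷ b ∷ c ∷ d ∷ e ∷ x ∷ y ∷ z ∷ []))

    α-equations : .{{_ : NonZero a}} → ΦEquations b (x * b - a) c d e x z (x * z - y)
    α-equations = record
      { x-eq = combination (+ 1) (+ 1) (+ 0) (+ 0) x-eq y-eq z-eq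
          (solve (a ∷ b ∷ c ∷ d ∷ e ∷ x ∷ y ∷ z ∷ []))
      ; y-eq = combination (a * a) {{i*j≢0 a a}}
          (- (c * d * d) - b * b * d + a * c * d * z - a * b * e - a * b * d * x + a * a * d)
          (+ 0) (c * d + b * b) x-eq y-eq z-eq
          (solve (a ∷ b ∷ c ∷ d ∷ e ∷ x ∷ y ∷ z ∷ []))
      ; z-eq = combination (a * a) {{i*j≢0 a a}}
          (- (c * d * d) - b * b * d + a * c * d * z - a * b * e - a * b * d * x + a * a * d)
          (- (a * a)) (c * d + b * b + a * a) x-eq y-eq z-eq
          (solve (a ∷ b ∷ c ∷ d ∷ e ∷ x ∷ y ∷ z ∷ []))
      }

    α⁻¹-exchange : (x * a - b) * b ≡ a * a + c * d
    α⁻¹-exchange = combination (+ 1) (+ 1) (+ 0) (+ 0) x-eq y-eq z-eq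
      (solve (a ∷ b ∷ c ∷ d ∷ e ∷ x ∷ y ∷ z ∷ []))

    α⁻¹-equations : .{{_ : NonZero b}} → ΦEquations (x * a - b) a c d e x (x * y - z) y
    α⁻¹-equations = record
      { x-eq = combination (+ 1) (+ 1) (+ 0) (+ 0) x-eq y-eq z-eq
          (solve (a ∷ b ∷ c ∷ d ∷ e ∷ x ∷ y ∷ z ∷ []))
      ; y-eq = combination (b * b) {{i*j≢0 b b}}
          (- (c * c * d) + b * c * d * y + b * b * c - a * b * e - a * b * c * x - a * a * c)
          (c * d + b * b + a * a) (- (b * b)) x-eq y-eq z-eq
          (solve (a ∷ b ∷ c ∷ d ∷ e ∷ x ∷ y ∷ z ∷ []))
      ; z-eq = combination (b * b) {{i*j≢0 b b}}
          (- (c * c * d) + b * c * d * y + b * b * c - a * b * e - a * b * c * x - a * a * c)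
          (c * d + a * a) (+ 0) x-eq y-eq z-eq
          (solve (a ∷ b ∷ c ∷ d ∷ e ∷ x ∷ y ∷ z ∷ []))
      }

    β-exchange : .{{_ : NonZero a}} → (z * c - x * b + a) * d ≡ a * c + b * e
    β-exchange = combination a (- d) (+ 0) (+ 1) x-eq y-eq z-eq
      (solve (a ∷ b ∷ c ∷ d ∷ e ∷ x ∷ y ∷ z ∷ []))

    β-equations : .{{_ : NonZero a}} .{{_ : NonZero d}} →
                  ΦEquations b c (z * c - x * b + a) a e y z x
    β-equations = record
      { x-eq = combination d d (+ 1) (- (+ 1)) x-eq y-eq z-eq
          (solve (a ∷ b ∷ c ∷ d ∷ e ∷ x ∷ y ∷ z ∷ []))
      ; y-eq = combination a (- (c * d) + a * c * z - a * b * x + a * a) (+ 0) c x-eq y-eq z-eq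
          (solve (a ∷ b ∷ c ∷ d ∷ e ∷ x ∷ y ∷ z ∷ []))
      ; z-eq = combination a (- (c * d) + a * c * z - a * b * x + a * a) (+ 0) c x-eq y-eq z-eq
          (solve (a ∷ b ∷ c ∷ d ∷ e ∷ x ∷ y ∷ z ∷ []))
      }

    β⁻¹-exchange : .{{_ : NonZero b}} → (y * d - x * a + b) * c ≡ d * b + a * e
    β⁻¹-exchange = combination b (- c) (+ 1) (+ 0) x-eq y-eq z-eq
      (solve (a ∷ b ∷ c ∷ d ∷ e ∷ x ∷ y ∷ z ∷ []))

    β⁻¹-equations : .{{_ : NonZero b}} .{{_ : NonZero c}} →
                    ΦEquations d a b (y * d - x * a + b) e z x y
    β⁻¹-equations = record
      { x-eq = combination c c (- (+ 1)) (+ 1) x-eq y-eq z-eq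
          (solve (a ∷ b ∷ c ∷ d ∷ e ∷ x ∷ y ∷ z ∷ []))
      ; y-eq = combination b (- (c * d) + b * d * y + b * b - a * b * x) d (+ 0) x-eq y-eq z-eq
          (solve (a ∷ b ∷ c ∷ d ∷ e ∷ x ∷ y ∷ z ∷ []))
      ; z-eq = combination b (- (c * d) + b * d * y + b * b - a * b * x) d (+ 0) x-eq y-eq z-eq
          (solve (a ∷ b ∷ c ∷ d ∷ e ∷ x ∷ y ∷ z ∷ []))
      }

  -- Defs' ι n is definitionally ιℤ (+ n).
  ιℤ : ℤ → ℚ
  ιℤ i = i / 1

  ιℤ⁵ : ℤ → ℤ → ℤ → ℤ → ℤ → Q5
  ιℤ⁵ a b c d e = ⟨_,_,_,_,_⟩ (ιℤ a) (ιℤ b) (ιℤ c) (ιℤ d) (ιℤ e)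

  ιℤ-mkℚ : ∀ i → ιℤ i ≡ mkℚ i 0 (coprime-sym (1-coprimeTo _))
  ιℤ-mkℚ i = ↥p/↧p≡p (mkℚ i 0 _)

  ιℤ-injective : ∀ {i j} → ιℤ i ≡ ιℤ j → i ≡ j
  ιℤ-injective {i} {j} eq = cong ↥_ (trans (sym (ιℤ-mkℚ i)) (trans eq (ιℤ-mkℚ j)))

  ιℤ-+ : ∀ i j → ιℤ (i + j) ≡ ιℤ i ℚ.+ ιℤ j
  ιℤ-+ i j rewrite ιℤ-mkℚ i | ιℤ-mkℚ j = cong (_/ 1) (+-*1 i j)
    where +-*1 : ∀ i j → i + j ≡ i * + 1 + j * + 1
          +-*1 = solve-∀

  ιℤ-* : ∀ i j → ιℤ (i * j) ≡ ιℤ i ℚ.* ιℤ j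
  ιℤ-* i j rewrite ιℤ-mkℚ i | ιℤ-mkℚ j = refl

  ιℤ-*₃ : ∀ i j k → ιℤ (i * j * k) ≡ ιℤ i ℚ.* ιℤ j ℚ.* ιℤ k
  ιℤ-*₃ i j k = trans (ιℤ-* (i * j) k) (cong (ℚ._* ιℤ k) (ιℤ-* i j))

  ιℤ-+₄ : ∀ i j k l → ιℤ (i + j + k + l) ≡ ιℤ i ℚ.+ ιℤ j ℚ.+ ιℤ k ℚ.+ ιℤ l
  ιℤ-+₄ i j k l = trans (ιℤ-+ (i + j + k) l)
    (cong (ℚ._+ ιℤ l) (trans (ιℤ-+ (i + j) k) (cong (ℚ._+ ιℤ k) (ιℤ-+ i j))))

  ιℤ-*+* : ∀ p q r s → ιℤ (p * q + r * s) ≡ ιℤ p ℚ.* ιℤ q ℚ.+ ιℤ r ℚ.* ιℤ s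
  ιℤ-*+* p q r s = trans (ιℤ-+ (p * q) (r * s)) (cong₂ ℚ._+_ (ιℤ-* p q) (ιℤ-* r s))

  ιℤ-≢0 : ∀ i .{{_ : NonZero i}} → ιℤ i ≢ 0ℚ
  ιℤ-≢0 i eq = ℕ.≢-nonZero⁻¹ ∣ i ∣ (cong ∣_∣ (ιℤ-injective {i} {+ 0} eq))

  ⊘-≡⇔ : ∀ {p q r} → r ≢ 0ℚ → (p ⊘ r ≡ q) ⇔ (p ≡ q ℚ.* r)
  ⊘-≡⇔ {p} {q} {r} r≢0 with r ≟ 0ℚ
  ... | yes r≡0 = ⊥-elim (r≢0 r≡0)
  ... | no r≢0′ = mk⇔ to from
    where
    instance _ = ≢-nonZero r≢0′
    open ≡-Reasoning
    to : p ℚ.* 1/ r ≡ q → p ≡ q ℚ.* r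
    to eq = begin
      p                   ≡⟨ ℚ.*-identityʳ p ⟨
      p ℚ.* ℚ.1ℚ          ≡⟨ cong (p ℚ.*_) (ℚ.*-inverseˡ r) ⟨
      p ℚ.* (1/ r ℚ.* r)  ≡⟨ ℚ.*-assoc p (1/ r) r ⟨
      p ℚ.* 1/ r ℚ.* r    ≡⟨ cong (ℚ._* r) eq ⟩
      q ℚ.* r             ∎
    from : p ≡ q ℚ.* r → p ℚ.* 1/ r ≡ q
    from refl = begin
      q ℚ.* r ℚ.* 1/ r    ≡⟨ ℚ.*-assoc q r (1/ r) ⟩
      q ℚ.* (r ℚ.* 1/ r)  ≡⟨ cong (q ℚ.*_) (ℚ.*-inverseʳ r) ⟩
      q ℚ.* ℚ.1ℚ          ≡⟨ ℚ.*-identityʳ q ⟩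
      q                   ∎

  ιℤ-⊘⇔ : ∀ n m {q N M} .{{_ : NonZero m}} → ιℤ n ≡ N → ιℤ m ≡ M →
          (N ⊘ M ≡ ιℤ q) ⇔ (q * m ≡ n)
  ιℤ-⊘⇔ n m {q} refl refl = mk⇔
    (λ eq → ιℤ-injective (trans (ιℤ-* q m) (sym (Equivalence.to ⊘-spec eq))))
    (λ { refl → Equivalence.from ⊘-spec (ιℤ-* q m) })
    where ⊘-spec = ⊘-≡⇔ (ιℤ-≢0 m)

  exchange-⊘ : ∀ n m p q r s .{{_ : NonZero m}} → n * m ≡ p * q + r * s →
               (ιℤ p ℚ.* ιℤ q ℚ.+ ιℤ r ℚ.* ιℤ s) ⊘ ιℤ m ≡ ιℤ n
  exchange-⊘ n m p q r s = Equivalence.from (ιℤ-⊘⇔ (p * q + r * s) m {n} (ιℤ-*+* p q r s) refl)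

  φˣ-⊘⇔ : ∀ a b c d e {q} .{{_ : NonZero a}} .{{_ : NonZero b}} →
          (Q3.x (φ (ιℤ⁵ a b c d e)) ≡ ιℤ q) ⇔ (q * (a * b) ≡ a * a + b * b + c * d)
  φˣ-⊘⇔ a b c d e {q} = ιℤ-⊘⇔ (a * a + b * b + c * d) (a * b) {q} {{i*j≢0 a b}}
    (trans (ιℤ-+ (a * a + b * b) (c * d)) (cong₂ ℚ._+_ (ιℤ-*+* a a b b) (ιℤ-* c d)))
    (ιℤ-* a b)

  φʸ-⊘⇔ : ∀ a b c d e {q} .{{_ : NonZero b}} .{{_ : NonZero c}} .{{_ : NonZero d}} →
          (Q3.y (φ (ιℤ⁵ a b c d e)) ≡ ιℤ q) ⇔
          (q * (b * c * d) ≡ c * c * d + a * a * c + b * b * d + a * b * e)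
  φʸ-⊘⇔ a b c d e {q} =
    ιℤ-⊘⇔ (c * c * d + a * a * c + b * b * d + a * b * e) (b * c * d) {q}
      {{i*j≢0 (b * c) d {{i*j≢0 b c}}}}
      (trans (ιℤ-+₄ (c * c * d) (a * a * c) (b * b * d) (a * b * e))
        (cong₂ ℚ._+_ (cong₂ ℚ._+_ (cong₂ ℚ._+_ (ιℤ-*₃ c c d) (ιℤ-*₃ a a c)) (ιℤ-*₃ b b d))
                     (ιℤ-*₃ a b e)))
      (ιℤ-*₃ b c d)

  φᶻ-⊘⇔ : ∀ a b c d e {q} .{{_ : NonZero a}} .{{_ : NonZero c}} .{{_ : NonZero d}} →
          (Q3.z (φ (ιℤ⁵ a b c d e)) ≡ ιℤ q) ⇔
          (q * (a * c * d) ≡ c * d * d + a * a * c + b * b * d + a * b * e)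
  φᶻ-⊘⇔ a b c d e {q} =
    ιℤ-⊘⇔ (c * d * d + a * a * c + b * b * d + a * b * e) (a * c * d) {q}
      {{i*j≢0 (a * c) d {{i*j≢0 a c}}}}
      (trans (ιℤ-+₄ (c * d * d) (a * a * c) (b * b * d) (a * b * e))
        (cong₂ ℚ._+_ (cong₂ ℚ._+_ (cong₂ ℚ._+_ (ιℤ-*₃ c d d) (ιℤ-*₃ a a c)) (ιℤ-*₃ b b d))
                     (ιℤ-*₃ a b e)))
      (ιℤ-*₃ a c d)

  positive-quotient : ∀ q {m n} → q * +[1+ m ] ≡ +[1+ n ] → ∃ λ k → q ≡ +[1+ k ]
  positive-quotient +[1+ k ] _ = k , refl
  positive-quotient +0 ()
  positive-quotient -[1+ _ ] ()

  quotient-isPosNat : ∀ {r q m n} → (q * m ≡ n → r ≡ ιℤ q) → q * m ≡ n →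
                      ∃ (λ k → q ≡ +[1+ k ]) → IsPosNat r
  quotient-isPosNat r≡ eq (k , refl) = k , r≡ eq

  ∣⇒DivBy : ∀ {ε i} → + ε ∣ i → DivBy ε (ιℤ i)
  ∣⇒DivBy (divides k eq) = k , cong ιℤ eq

  DivBy⇒∣ : ∀ {ε i} → DivBy ε (ιℤ i) → + ε ∣ i
  DivBy⇒∣ (k , eq) = divides k (ιℤ-injective eq)

  -- Each ℕ-field n (and the parameter e) stands for the positive integer +[1+ n ]; then every
  -- polynomial with nonnegative coefficients in them computes to the form +[1+ _ ], which is
  -- how positive-quotient sees that the new coordinates are positive.
  record Admissible (e : ℕ) : Set where
    constructor admissible
    field
      a b c d : ℕ
      x y z : ℤ
      φ-equations : ΦEquations +[1+ a ] +[1+ b ] +[1+ c ] +[1+ d ] +[1+ e ] x y z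
      ε∣a : +[1+ e ] ∣ +[1+ a ]
      ε∣b : +[1+ e ] ∣ +[1+ b ]
      ε∣c : +[1+ e ] ∣ +[1+ c ]
      ε∣d : +[1+ e ] ∣ +[1+ d ]

    point : Q5
    point = ιℤ⁵ +[1+ a ] +[1+ b ] +[1+ c ] +[1+ d ] +[1+ e ]

  open Admissible using (point)

  AdmissibleImage : ∀ {e} → (Q5 → Q5) → Admissible e → Set
  AdmissibleImage {e} f s = Σ[ s′ ∈ Admissible e ] f (point s) ≡ point s′

  α-step : ∀ {e} (s : Admissible e) → AdmissibleImage αmap s
  α-step (admissible a b c d x y z eqs ε∣a ε∣b ε∣c ε∣d) =
    let a′ , a′≡ = positive-quotient (x * B - A) (α-exchange eqs) in
    admissible b a′ c d x z (x * z - y)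
      (subst (λ u → ΦEquations B u C D _ x z (x * z - y)) a′≡ (α-equations eqs))
      ε∣b (subst (_ ∣_) a′≡ (∣m∣n⇒∣m-n (∣n⇒∣m*n x ε∣b) ε∣a)) ε∣c ε∣d ,
    cong (λ q → ⟨_,_,_,_,_⟩ _ q _ _ _)
      (trans (exchange-⊘ (x * B - A) A B B C D (α-exchange eqs)) (cong ιℤ a′≡))
    where A = +[1+ a ]; B = +[1+ b ]; C = +[1+ c ]; D = +[1+ d ]

  α⁻¹-step : ∀ {e} (s : Admissible e) → AdmissibleImage αinv s
  α⁻¹-step (admissible a b c d x y z eqs ε∣a ε∣b ε∣c ε∣d) =
    let b′ , b′≡ = positive-quotient (x * A - B) (α⁻¹-exchange eqs) in
    admissible b′ a c d x (x * y - z) y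
      (subst (λ u → ΦEquations u A C D _ x (x * y - z) y) b′≡ (α⁻¹-equations eqs))
      (subst (_ ∣_) b′≡ (∣m∣n⇒∣m-n (∣n⇒∣m*n x ε∣a) ε∣b)) ε∣a ε∣c ε∣d ,
    cong (λ q → ⟨_,_,_,_,_⟩ q _ _ _ _)
      (trans (exchange-⊘ (x * A - B) B A A C D (α⁻¹-exchange eqs)) (cong ιℤ b′≡))
    where A = +[1+ a ]; B = +[1+ b ]; C = +[1+ c ]; D = +[1+ d ]

  β-step : ∀ {e} (s : Admissible e) → AdmissibleImage βmap s
  β-step {e} (admissible a b c d x y z eqs ε∣a ε∣b ε∣c ε∣d) =
    let c′ , c′≡ = positive-quotient (z * C - x * B + A) (β-exchange eqs) in
    admissible b c c′ a y z x
      (subst (λ u → ΦEquations B C u A E y z x) c′≡ (β-equations eqs))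
      ε∣b ε∣c (subst (_ ∣_) c′≡ (∣m∣n⇒∣m+n (∣m∣n⇒∣m-n (∣n⇒∣m*n z ε∣c) (∣n⇒∣m*n x ε∣b)) ε∣a))
      ε∣a ,
    cong (λ q → ⟨_,_,_,_,_⟩ _ _ q _ _)
      (trans (exchange-⊘ (z * C - x * B + A) D A C B E (β-exchange eqs)) (cong ιℤ c′≡))
    where A = +[1+ a ]; B = +[1+ b ]; C = +[1+ c ]; D = +[1+ d ]; E = +[1+ e ]

  β⁻¹-step : ∀ {e} (s : Admissible e) → AdmissibleImage βinv s
  β⁻¹-step {e} (admissible a b c d x y z eqs ε∣a ε∣b ε∣c ε∣d) =
    let d′ , d′≡ = positive-quotient (y * D - x * A + B) (β⁻¹-exchange eqs) in
    admissible d a b d′ z x y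
      (subst (λ u → ΦEquations D A B u E z x y) d′≡ (β⁻¹-equations eqs))
      ε∣d ε∣a ε∣b
      (subst (_ ∣_) d′≡ (∣m∣n⇒∣m+n (∣m∣n⇒∣m-n (∣n⇒∣m*n y ε∣d) (∣n⇒∣m*n x ε∣a)) ε∣b)) ,
    cong (λ q → ⟨_,_,_,_,_⟩ _ _ _ q _)
      (trans (exchange-⊘ (y * D - x * A + B) C D B A E (β⁻¹-exchange eqs)) (cong ιℤ d′≡))
    where A = +[1+ a ]; B = +[1+ b ]; C = +[1+ c ]; D = +[1+ d ]; E = +[1+ e ]

  generator-step : ∀ {e} g (s : Admissible e) → AdmissibleImage (genMap g) s
  generator-step α   = α-step
  generator-step α⁻¹ = α⁻¹-step
  generator-step β   = β-step
  generator-step β⁻¹ = β⁻¹-step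

  act-step : ∀ {e} w (s : Admissible e) → AdmissibleImage (act w) s
  act-step []      s = s , refl
  act-step (g ∷ w) s =
    let s′ , wP≡P′ = act-step w s
        s″ , gP′≡P″ = generator-step g s′
    in s″ , trans (cong (genMap g) wP≡P′) gP′≡P″

  φ-integral : ∀ {e} (s : Admissible e) → InN3 (φ (point s))
  φ-integral {e} (admissible a b c d x y z eqs _ _ _ _) =
      quotient-isPosNat (Equivalence.from (φˣ-⊘⇔ A B C D E {x})) x-eq (positive-quotient x x-eq)
    , quotient-isPosNat (Equivalence.from (φʸ-⊘⇔ A B C D E {y})) y-eq (positive-quotient y y-eq)
    , quotient-isPosNat (Equivalence.from (φᶻ-⊘⇔ A B C D E {z})) z-eq (positive-quotient z z-eq)
    where open ΦEquations eqs
          A = +[1+ a ]; B = +[1+ b ]; C = +[1+ c ]; D = +[1+ d ]; E = +[1+ e ]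

  ε-divides : ∀ {e} (s : Admissible e) → Zmod (suc e) (point s)
  ε-divides (admissible _ _ _ _ _ _ _ _ ε∣a ε∣b ε∣c ε∣d) =
    ∣⇒DivBy ε∣a , ∣⇒DivBy ε∣b , ∣⇒DivBy ε∣c , ∣⇒DivBy ε∣d , ∣⇒DivBy ∣-refl

  point-invariants : ∀ {e} (s : Admissible e) → InN3 (φ (point s)) × Zmod (suc e) (point s)
  point-invariants s = φ-integral s , ε-divides s

  admissible-at : ∀ e a b c d → let P = ιℤ⁵ +[1+ a ] +[1+ b ] +[1+ c ] +[1+ d ] +[1+ e ] in
                  InN3 (φ P) → Zmod (suc e) P → Σ[ s ∈ Admissible e ] point s ≡ P
  admissible-at e a b c d ((x , φˣ) , (y , φʸ) , (z , φᶻ)) (ε∣a , ε∣b , ε∣c , ε∣d , _) =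
    admissible a b c d +[1+ x ] +[1+ y ] +[1+ z ]
      (record { x-eq = Equivalence.to (φˣ-⊘⇔ A B C D E {+[1+ x ]}) φˣ
              ; y-eq = Equivalence.to (φʸ-⊘⇔ A B C D E {+[1+ y ]}) φʸ
              ; z-eq = Equivalence.to (φᶻ-⊘⇔ A B C D E {+[1+ z ]}) φᶻ })
      (DivBy⇒∣ ε∣a) (DivBy⇒∣ ε∣b) (DivBy⇒∣ ε∣c) (DivBy⇒∣ ε∣d) ,
    refl
    where A = +[1+ a ]; B = +[1+ b ]; C = +[1+ c ]; D = +[1+ d ]; E = +[1+ e ]

open Orbit using (act-step; admissible-at; point-invariants)

lemma5p1 : (ε a b c d : ℕ) → 0 < ε → 0 < a → 0 < b → 0 < c → 0 < d →
    InN3 (φ ⟨ ι a , ι b , ι c , ι d , ι ε ⟩) →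
    Zmod ε ⟨ ι a , ι b , ι c , ι d , ι ε ⟩ →
    (g : Word) →
      InN3 (φ (act g ⟨ ι a , ι b , ι c , ι d , ι ε ⟩)) ×
      Zmod ε (act g ⟨ ι a , ι b , ι c , ι d , ι ε ⟩)
lemma5p1 (suc e) (suc a) (suc b) (suc c) (suc d) z<s z<s z<s z<s z<s φP∈ℕ³ P≡0 g =
  subst (λ Q → InN3 (φ Q) × Zmod (suc e) Q) (sym gP≡image) (point-invariants (proj₁ image))
  where
  start = admissible-at e a b c d φP∈ℕ³ P≡0
  image = act-step g (proj₁ start)
  gP≡image = trans (cong (act g) (sym (proj₂ start))) (proj₂ image)
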